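{- Let $G$ be a minimal counterexample (as defined in the context). Let $1\leq k\leq 3$, let $up_1\cdots p_kv$ be a $k$-path in $G$ and let $P=\{p_1,\dots,p_k\}$. If $\rho^*_{G-P}(\{u\})\leq \rho^*_{G-P}(\{v\})$, then $\rho^*_{G-P}(\{v\})\geq 1$.
   Context: A $2$-distance $k$-coloring of a graph assigns colors from $\{1,\dots,k\}$ so that distinct vertices at distance at most $2$ get different colors. A minimal counterexample is a finite simple graph $G$ with $\mathrm{mad}(G)\leq 18/7$ (equivalently $\rho_G(A)\geq 0$ for all $A\subseteq V(G)$), maximum degree $\Delta(G)=7$, that has no $2$-distance $8$-coloring, and such that every graph $H$ with $\mathrm{mad}(H)\leq 18/7$, maximum degree at most $7$ and $|V(H)|+|E(H)|<|V(G)|+|E(G)|$ has a $2$-distance $8$-coloring. For a graph $F$ and $A\subseteq V(F)$, $\rho_F(A)=9|A|-7|E(F[A])|$ and $\rho^*_F(A)=\min\{\rho_F(S):A\subseteq S\subseteq V(F)\}$. A $k$-path is a path of length $k+1$ whose $k$ internal vertices have degree $2$ in $G$. $G-P$ is obtained by deleting the vertices of $P$. -}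

module Defs where

open import Data.Nat using (ℕ; zero; suc; _+_; _*_; _<_; _≤_; _<ᵇ_)
open import Data.Integer using (ℤ; +_; _-_; _⊓_)
open import Data.Bool using (Bool; true; false; _∧_; _∨_; not; if_then_else_)
open import Data.Fin using (Fin; zero; suc; inject₁; fromℕ; toℕ)
open import Data.Fin.Properties using () renaming (_≟_ to _≟ᶠ_)
open import Data.List using (List; []; _∷_; map; foldr; filter; _++_; allFin)
open import Data.Nat.ListAction using (sum)
open import Data.Bool.ListAction using (any; all)
open import Data.Product using (Σ; _×_; ∃; ∃-syntax)
open import Data.Sum using (_⊎_)
open import Relation.Nullary using (¬_; does)
open import Relation.Binary.PropositionalEquality using (_≡_; _≢_)
open import Function.Definitions using (Injective)

record Graph : Set where
  field
    n      : ℕ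
    adj    : Fin n → Fin n → Bool
    sym    : ∀ i j → adj i j ≡ adj j i
    irrefl : ∀ i → adj i i ≡ false
open Graph public

b2n : Bool → ℕ
b2n true  = 1
b2n false = 0

VSet : ℕ → Set
VSet n = Fin n → Bool

card : ∀ {n} → VSet n → ℕ
card {n} A = sum (map (λ i → b2n (A i)) (allFin n))

degree : (G : Graph) → Fin (n G) → ℕ
degree G v = sum (map (λ j → b2n (adj G v j)) (allFin (n G)))

edgesIn : (G : Graph) → VSet (n G) → ℕ
edgesIn G A = sum (map (λ i → sum (map (λ j →
  b2n ((toℕ i <ᵇ toℕ j) ∧ A i ∧ A j ∧ adj G i j)) (allFin (n G)))) (allFin (n G)))

full : (G : Graph) → VSet (n G)
full G _ = true

numEdges : Graph → ℕ
numEdges G = edgesIn G (full G)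

size : Graph → ℕ
size G = n G + numEdges G

ρ : (G : Graph) → VSet (n G) → ℤ
ρ G A = + (9 * card A) - + (7 * edgesIn G A)

-- mad(G) ≤ 18/7, in the (stated equivalent) form ρ_G(A) ≥ 0 for all A ⊆ V(G)
MadOK : Graph → Set
MadOK G = ∀ (A : VSet (n G)) → + 0 Data.Integer.≤ ρ G A

MaxDegLe : Graph → ℕ → Set
MaxDegLe G d = ∀ v → degree G v ≤ d

MaxDegEq : Graph → ℕ → Set
MaxDegEq G d = MaxDegLe G d × ∃[ v ] degree G v ≡ d

Dist≤2 : (G : Graph) → Fin (n G) → Fin (n G) → Set
Dist≤2 G u v = adj G u v ≡ true ⊎ ∃[ w ] (adj G u w ≡ true × adj G w v ≡ true)

TwoDistColoring : (G : Graph) → (k : ℕ) → Set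
TwoDistColoring G k =
  Σ (Fin (n G) → Fin k) λ c →
    ∀ u v → u ≢ v → Dist≤2 G u v → c u ≢ c v

record MinimalCounterexample (G : Graph) : Set where
  field
    madOK     : MadOK G
    maxDeg7   : MaxDegEq G 7
    noColor   : ¬ TwoDistColoring G 8
    minimal   : ∀ (H : Graph) → MadOK H → MaxDegLe H 7 → size H < size G →
                TwoDistColoring H 8

allSubsets : (m : ℕ) → List (VSet m)
allSubsets zero = (λ ()) ∷ []
allSubsets (suc m) =
  map (λ S → λ { zero → true ; (suc i) → S i }) (allSubsets m) ++
  map (λ S → λ { zero → false ; (suc i) → S i }) (allSubsets m)

_⊆ᵇ_ : ∀ {m} → VSet m → VSet m → Bool
_⊆ᵇ_ {m} A B = all (λ i → not (A i) ∨ B i) (allFin m)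

-- For X ⊆ V(G), the graph G[X] (e.g. X = V(G) ∖ P gives G - P).
-- ρ_{G[X]}(S) = ρ_G(S) for S ⊆ X, so
-- ρ*_{G[X]}(A) = min { ρ_G(S) : A ⊆ S ⊆ X }   (for A ⊆ X; X itself is a candidate).
ρ*In : (G : Graph) → (X : VSet (n G)) → VSet (n G) → ℤ
ρ*In G X A =
  foldr _⊓_ (ρ G X)
    (map (ρ G) (filter (λ S → (A ⊆ᵇ S) ∧ (S ⊆ᵇ X) Data.Bool.≟ true) (allSubsets (n G))))

singleton : ∀ {m} → Fin m → VSet m
singleton x y = does (x ≟ᶠ y)

-- A k-path u p₁ ⋯ p_k v given as an injective walk w : Fin (k+2) → V(G)
-- with w 0 = u, w (k+1) = v, consecutive vertices adjacent, and
-- every internal vertex p_i = w i (1 ≤ i ≤ k) of degree 2 in G.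
record KPath (G : Graph) (k : ℕ) : Set where
  field
    w         : Fin (suc (suc k)) → Fin (n G)
    injective : Injective _≡_ _≡_ w
    adjacent  : ∀ (i : Fin (suc k)) → adj G (w (inject₁ i)) (w (suc i)) ≡ true
    deg2      : ∀ (i : Fin k) → degree G (w (suc (inject₁ i))) ≡ 2
  start : Fin (n G)
  start = w zero
  end : Fin (n G)
  end = w (fromℕ (suc k))
  inP : VSet (n G)
  inP x = any (λ i → does (w (suc (inject₁ i)) ≟ᶠ x)) (allFin k)
  outsideP : VSet (n G)
  outsideP x = not (inP x)

module Submission where

-- Suppose ρ*_{G-P}(v) ≤ 0; then also ρ*_{G-P}(u) ≤ 0. Take sets S_u ∋ u and S_v ∋ v inside G - P
-- attaining these minima. ρ is submodular and, as mad(G) ≤ 18/7, nonnegative, so T = S_u ∪ S_v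
-- has ρ(T) ≤ ρ(S_u) + ρ(S_v) - ρ(S_u ∩ S_v) ≤ 0. Putting p₁, …, p_k back adds k vertices and at
-- least the k + 1 edges of the path, so ρ(T ∪ P) ≤ ρ(T) + 9k - 7(k + 1) ≤ 2k - 7 < 0 for k ≤ 3,
-- contradicting mad(G) ≤ 18/7.

open import Defs renaming (sym to adj-sym)
open import Data.Nat using (ℕ; zero; suc; _+_; _*_; _≤_; _<_; _<ᵇ_; z≤n; s≤s)
open import Data.Nat.Properties
  using (≤-refl; ≤-reflexive; ≤-trans; +-mono-≤; +-monoˡ-≤; +-monoʳ-≤; *-monoʳ-≤; +-cancelʳ-≤;
         +-identityʳ; *-identityʳ; *-identityˡ; *-zeroʳ; *-distribʳ-+; *-distribˡ-+; m≤m+n;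
         +-commutativeSemigroup; +-assoc; +-comm; <⇒≱; module ≤-Reasoning)
open import Data.Nat.Tactic.RingSolver using (solve-∀)
open import Data.Nat.ListAction using (sum)
open import Data.Bool using (Bool; true; false; _∧_; _∨_; not; T) renaming (_≟_ to _≟ᵇ_)
open import Data.Bool.Properties
  using (∧-conicalˡ; ∧-conicalʳ; ∨-zeroʳ; ∧-identityʳ; ∧-zeroʳ; T-≡; ¬-not; ∧-commutativeMonoid)
open import Data.Fin using (Fin; zero; suc; toℕ; inject₁; fromℕ)
open import Data.Fin.Properties using (suc-injective; fromℕ≢inject₁) renaming (_≟_ to _≟ᶠ_)
open import Data.List using ([]; _∷_; map; filter; allFin)
open import Data.List.Properties using (map-tabulate)
open import Data.List.Membership.Propositional.Properties using (∈-allFin; ∈-map⁻; ∈-filter⁻; foldr-selective)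
import Data.List.Relation.Unary.Any as Any
import Data.List.Relation.Unary.All as All
open import Data.List.Relation.Unary.Any.Properties using (any⁺; any⁻)
open import Data.List.Relation.Unary.All.Properties using (all⁺)
open import Data.Integer using (+_) renaming (_≤_ to _≤ℤ_)
import Data.Integer.Properties as ℤ
open import Data.Product using (∃-syntax; _×_; _,_)
open import Data.Sum using (inj₁; inj₂)
open import Data.Empty using (⊥; ⊥-elim)
open import Function using (_∘_)
open import Function.Bundles using (Equivalence)
open import Function.Definitions using (Injective)
open import Relation.Nullary using (Dec; does; yes; no)
open import Relation.Nullary.Decidable using (dec-true; dec-false)
open import Relation.Binary.PropositionalEquality
open import Algebra.Bundles using (CommutativeMonoid)
open import Algebra.Properties.CommutativeSemigroup +-commutativeSemigroup
  using () renaming (interchange to +-interchange)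
open import Algebra.Properties.CommutativeSemigroup (CommutativeMonoid.commutativeSemigroup ∧-commutativeMonoid)
  using () renaming (interchange to ∧-interchange)

open Equivalence using (to; from)

b2n-mono : ∀ {a b} → (a ≡ true → b ≡ true) → b2n a ≤ b2n b
b2n-mono {false} _ = z≤n
b2n-mono {true} a⇒b rewrite a⇒b refl = ≤-refl

b2n-∨-∧ : ∀ a b → b2n (a ∨ b) + b2n (a ∧ b) ≡ b2n a + b2n b
b2n-∨-∧ false false = refl
b2n-∨-∧ false true  = refl
b2n-∨-∧ true  false = refl
b2n-∨-∧ true  true  = refl

b2n-∨-disjoint : ∀ a b → a ∧ b ≡ false → b2n (a ∨ b) ≡ b2n a + b2n b
b2n-∨-disjoint a b a∧b =
  trans (sym (+-identityʳ _)) (trans (cong (λ c → b2n (a ∨ b) + b2n c) (sym a∧b)) (b2n-∨-∧ a b))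

∨-of-pairs : ∀ ai bi aj bj → (ai ∧ aj) ∨ (bi ∧ bj) ≡ true → (ai ∨ bi) ∧ (aj ∨ bj) ≡ true
∨-of-pairs true  bi true  bj _ = refl
∨-of-pairs true  bi false bj h rewrite ∧-conicalʳ bi bj h = refl
∨-of-pairs false bi true  bj h rewrite ∧-conicalˡ bi bj h = refl
∨-of-pairs false bi false bj h = h

pair-supermodular : ∀ c ai bi aj bj →
  b2n (c ∧ (ai ∧ aj)) + b2n (c ∧ (bi ∧ bj)) ≤
  b2n (c ∧ ((ai ∨ bi) ∧ (aj ∨ bj))) + b2n (c ∧ ((ai ∧ bi) ∧ (aj ∧ bj)))
pair-supermodular false _ _ _ _ = z≤n
pair-supermodular true ai bi aj bj = begin
  b2n (ai ∧ aj) + b2n (bi ∧ bj)                              ≡⟨ sym (b2n-∨-∧ (ai ∧ aj) (bi ∧ bj)) ⟩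
  b2n ((ai ∧ aj) ∨ (bi ∧ bj)) + b2n ((ai ∧ aj) ∧ (bi ∧ bj))
    ≤⟨ +-mono-≤ (b2n-mono (∨-of-pairs ai bi aj bj)) (≤-reflexive (cong b2n (∧-interchange ai aj bi bj))) ⟩
  b2n ((ai ∨ bi) ∧ (aj ∨ bj)) + b2n ((ai ∧ bi) ∧ (aj ∧ bj))   ∎
  where open ≤-Reasoning

-- For a pair (i, j) guarded by c: di, dj tell whether i, j are a vertex x ∉ T being inserted,
-- ti, tj whether they lie in T; the two products are the new pairs (x, j) and (i, x).
pair-insert : ∀ c di dj ti tj → di ∧ ti ≡ false → dj ∧ tj ≡ false →
  b2n (c ∧ (ti ∧ tj)) + (b2n (c ∧ tj) * b2n di + b2n (c ∧ ti) * b2n dj) ≤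
  b2n (c ∧ ((di ∨ ti) ∧ (dj ∨ tj)))
pair-insert false _     _     _     _     _  _  = z≤n
pair-insert true  false false true  true  _  _  = ≤-refl
pair-insert true  true  _     true  _     () _
pair-insert true  _     true  _     true  _  ()
pair-insert true  false true  true  false _  _  = ≤-refl
pair-insert true  false false true  false _  _  = z≤n
pair-insert true  true  false false true  _  _  = ≤-refl
pair-insert true  false false false true  _  _  = z≤n
pair-insert true  _     _     false false _  _  = z≤n

∧-edge-term : ∀ l a b e → l ∧ a ∧ b ∧ e ≡ (l ∧ e) ∧ (a ∧ b)
∧-edge-term false a b e     = refl
∧-edge-term true  a b true  = cong (a ∧_) (∧-identityʳ b)
∧-edge-term true  a b false = trans (cong (a ∧_) (∧-zeroʳ b)) (∧-zeroʳ a)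

either-order : ∀ l₁ l₂ a t → l₁ ∨ l₂ ≡ true → b2n (a ∧ t) ≤ b2n ((l₁ ∧ a) ∧ t) + b2n ((l₂ ∧ a) ∧ t)
either-order true  l₂ a t _ = m≤m+n _ _
either-order false l₂ a t l₂≡true rewrite l₂≡true = ≤-refl

<ᵇ-connex : ∀ {m} {x y : Fin m} → x ≢ y → (toℕ x <ᵇ toℕ y) ∨ (toℕ y <ᵇ toℕ x) ≡ true
<ᵇ-connex {x = zero}  {zero}  x≢y = ⊥-elim (x≢y refl)
<ᵇ-connex {x = zero}  {suc y} _   = refl
<ᵇ-connex {x = suc x} {zero}  _   = refl
<ᵇ-connex {x = suc x} {suc y} x≢y = <ᵇ-connex (x≢y ∘ cong suc)

∑ : ∀ {n} → (Fin n → ℕ) → ℕ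
∑ f = sum (map f (allFin _))

module _ {A : Set} where

  sum-map-distrib-+ : ∀ (f g : A → ℕ) xs →
    sum (map (λ x → f x + g x) xs) ≡ sum (map f xs) + sum (map g xs)
  sum-map-distrib-+ f g [] = refl
  sum-map-distrib-+ f g (x ∷ xs) =
    trans (cong (_+_ (f x + g x)) (sum-map-distrib-+ f g xs)) (+-interchange (f x) (g x) _ _)

  sum-map-mono-≤ : ∀ {f g : A → ℕ} → (∀ x → f x ≤ g x) → ∀ xs → sum (map f xs) ≤ sum (map g xs)
  sum-map-mono-≤ f≤g [] = z≤n
  sum-map-mono-≤ f≤g (x ∷ xs) = +-mono-≤ (f≤g x) (sum-map-mono-≤ f≤g xs)

  sum-map-cong : ∀ {f g : A → ℕ} → (∀ x → f x ≡ g x) → ∀ xs → sum (map f xs) ≡ sum (map g xs)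
  sum-map-cong f≗g [] = refl
  sum-map-cong f≗g (x ∷ xs) = cong₂ _+_ (f≗g x) (sum-map-cong f≗g xs)

  sum-map-distribʳ-* : ∀ (f : A → ℕ) c xs → sum (map (λ x → f x * c) xs) ≡ sum (map f xs) * c
  sum-map-distribʳ-* f c [] = refl
  sum-map-distribʳ-* f c (x ∷ xs) =
    trans (cong (_+_ (f x * c)) (sum-map-distribʳ-* f c xs)) (sym (*-distribʳ-+ c (f x) _))

module _ {n : ℕ} where

  ∑-distrib-+ : ∀ (f g : Fin n → ℕ) → ∑ (λ i → f i + g i) ≡ ∑ f + ∑ g
  ∑-distrib-+ f g = sum-map-distrib-+ f g (allFin n)

  ∑-mono-≤ : ∀ {f g : Fin n → ℕ} → (∀ i → f i ≤ g i) → ∑ f ≤ ∑ g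
  ∑-mono-≤ f≤g = sum-map-mono-≤ f≤g (allFin n)

  ∑-cong : ∀ {f g : Fin n → ℕ} → (∀ i → f i ≡ g i) → ∑ f ≡ ∑ g
  ∑-cong f≗g = sum-map-cong f≗g (allFin n)

  ∑-distribʳ-* : ∀ (f : Fin n → ℕ) c → ∑ (λ i → f i * c) ≡ ∑ f * c
  ∑-distribʳ-* f c = sum-map-distribʳ-* f c (allFin n)

  ∑-+-mono-≤ : ∀ {f g h k : Fin n → ℕ} → (∀ i → f i + g i ≤ h i + k i) → ∑ f + ∑ g ≤ ∑ h + ∑ k
  ∑-+-mono-≤ {f} {g} {h} {k} le = begin
    ∑ f + ∑ g              ≡⟨ sym (∑-distrib-+ f g) ⟩
    ∑ (λ i → f i + g i)    ≤⟨ ∑-mono-≤ le ⟩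
    ∑ (λ i → h i + k i)    ≡⟨ ∑-distrib-+ h k ⟩
    ∑ h + ∑ k              ∎
    where open ≤-Reasoning

  ∑-distrib-+₃ : ∀ (f g h : Fin n → ℕ) → ∑ f + (∑ g + ∑ h) ≡ ∑ (λ i → f i + (g i + h i))
  ∑-distrib-+₃ f g h =
    sym (trans (∑-distrib-+ f (λ i → g i + h i)) (cong (_+_ (∑ f)) (∑-distrib-+ g h)))

∑-suc : ∀ {n} (f : Fin (suc n) → ℕ) → ∑ f ≡ f zero + ∑ (f ∘ suc)
∑-suc f = cong (λ xs → f zero + sum xs) (trans (map-tabulate suc f) (sym (map-tabulate (λ i → i) (f ∘ suc))))

δ : ∀ {n} → Fin n → Fin n → ℕ
δ x i = b2n (does (x ≟ᶠ i))

∑-δ : ∀ {n} (f : Fin n → ℕ) x → ∑ (λ i → f i * δ x i) ≡ f x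
∑-δ {suc n} f zero = begin
  ∑ (λ i → f i * δ zero i)               ≡⟨ ∑-suc (λ i → f i * δ zero i) ⟩
  f zero * 1 + ∑ (λ i → f (suc i) * 0)   ≡⟨ cong₂ _+_ (*-identityʳ (f zero)) (∑-distribʳ-* (f ∘ suc) 0) ⟩
  f zero + ∑ (f ∘ suc) * 0               ≡⟨ cong (_+_ (f zero)) (*-zeroʳ (∑ (f ∘ suc))) ⟩
  f zero + 0                             ≡⟨ +-identityʳ (f zero) ⟩
  f zero                                 ∎
  where open ≡-Reasoning
∑-δ {suc n} f (suc x) = trans (∑-suc (λ i → f i * δ (suc x) i)) (cong₂ _+_ (*-zeroʳ (f zero)) (∑-δ (f ∘ suc) x))

∑-δ≡1 : ∀ {n} (x : Fin n) → ∑ (δ x) ≡ 1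
∑-δ≡1 x = trans (∑-cong (λ i → sym (*-identityˡ (δ x i)))) (∑-δ (λ _ → 1) x)

∑∑-δ-row : ∀ {n} (f : Fin n → Fin n → ℕ) x → ∑ (λ i → ∑ (λ j → f i j * δ x i)) ≡ ∑ (f x)
∑∑-δ-row f x = trans (∑-cong (λ i → ∑-distribʳ-* (f i) (δ x i))) (∑-δ (λ i → ∑ (f i)) x)

∑∑-δ-column : ∀ {n} (f : Fin n → Fin n → ℕ) x → ∑ (λ i → ∑ (λ j → f i j * δ x j)) ≡ ∑ (λ i → f i x)
∑∑-δ-column f x = ∑-cong (λ i → ∑-δ (f i) x)

weighted-∑≤∑ : ∀ {n} (f c : Fin n → ℕ) → (∀ i → c i ≤ 1) → ∑ (λ i → f i * c i) ≤ ∑ f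
weighted-∑≤∑ f c c≤1 = ∑-mono-≤ (λ i → ≤-trans (*-monoʳ-≤ (f i) (c≤1 i)) (≤-reflexive (*-identityʳ (f i))))

term≤∑ : ∀ {n} (f : Fin n → ℕ) x → f x ≤ ∑ f
term≤∑ f x = ≤-trans (≤-reflexive (sym (∑-δ f x))) (weighted-∑≤∑ f (δ x) δ≤1)
  where
  δ≤1 : ∀ i → δ x i ≤ 1
  δ≤1 i with x ≟ᶠ i
  ... | yes _ = ≤-refl
  ... | no _  = z≤n

pair≤∑ : ∀ {n} (f : Fin n → ℕ) {x y} → x ≢ y → f x + f y ≤ ∑ f
pair≤∑ f {x} {y} x≢y = begin
  f x + f y                                       ≡⟨ sym (cong₂ _+_ (∑-δ f x) (∑-δ f y)) ⟩
  ∑ (λ i → f i * δ x i) + ∑ (λ i → f i * δ y i)   ≡⟨ sym (∑-distrib-+ (λ i → f i * δ x i) (λ i → f i * δ y i)) ⟩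
  ∑ (λ i → f i * δ x i + f i * δ y i)             ≡⟨ ∑-cong (λ i → sym (*-distribˡ-+ (f i) (δ x i) (δ y i))) ⟩
  ∑ (λ i → f i * (δ x i + δ y i))                 ≤⟨ weighted-∑≤∑ f (λ i → δ x i + δ y i) δ+δ≤1 ⟩
  ∑ f                                             ∎
  where
  open ≤-Reasoning
  δ+δ≤1 : ∀ i → δ x i + δ y i ≤ 1
  δ+δ≤1 i with x ≟ᶠ i | y ≟ᶠ i
  ... | yes refl | yes refl = ⊥-elim (x≢y refl)
  ... | yes _    | no _     = ≤-refl
  ... | no _     | yes _    = ≤-refl
  ... | no _     | no _     = z≤n

module _ {n : ℕ} where

  infix  4 _⊆_
  infixr 6 _∩_
  infixr 5 _∪_

  _⊆_ : VSet n → VSet n → Set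
  A ⊆ B = ∀ i → A i ≡ true → B i ≡ true

  _∪_ : VSet n → VSet n → VSet n
  (A ∪ B) i = A i ∨ B i

  _∩_ : VSet n → VSet n → VSet n
  (A ∩ B) i = A i ∧ B i

  insert : Fin n → VSet n → VSet n
  insert x A i = does (x ≟ᶠ i) ∨ A i

  ⊆ᵇ⇒⊆ : ∀ {A B : VSet n} → (A ⊆ᵇ B) ≡ true → A ⊆ B
  ⊆ᵇ⇒⊆ {A} {B} A⊆ᵇB i Ai =
    to T-≡ (subst (λ b → T (not b ∨ B i)) Ai (All.lookup (all⁺ _ (allFin n) (from T-≡ A⊆ᵇB)) (∈-allFin i)))

  ∪-⊆ : ∀ {A B C : VSet n} → A ⊆ C → B ⊆ C → A ∪ B ⊆ C
  ∪-⊆ {A} A⊆C B⊆C i A∪Bi with A i in Ai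
  ... | true  = A⊆C i Ai
  ... | false = B⊆C i A∪Bi

  ⊆-∉ : ∀ {A B : VSet n} {x} → A ⊆ B → B x ≡ false → A x ≡ false
  ⊆-∉ {A} {x = x} A⊆B Bx with A x in Ax
  ... | true  = trans (sym (A⊆B x Ax)) Bx
  ... | false = refl

  insert-∋ : ∀ x (A : VSet n) → insert x A x ≡ true
  insert-∋ x A = cong (_∨ A x) (dec-true (x ≟ᶠ x) refl)

  insert-⊇ : ∀ x (A : VSet n) {y} → A y ≡ true → insert x A y ≡ true
  insert-⊇ x A Ay = trans (cong (does (x ≟ᶠ _) ∨_) Ay) (∨-zeroʳ _)

  insert-∌ : ∀ x (A : VSet n) {y} → x ≢ y → insert x A y ≡ A y
  insert-∌ x A x≢y = cong (_∨ A _) (dec-false (x ≟ᶠ _) x≢y)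

  insert-disjoint : ∀ x {A : VSet n} → A x ≡ false → ∀ i → does (x ≟ᶠ i) ∧ A i ≡ false
  insert-disjoint x Ax i with x ≟ᶠ i
  ... | yes refl = Ax
  ... | no _     = refl

  card-∪-∩ : ∀ (A B : VSet n) → card (A ∪ B) + card (A ∩ B) ≡ card A + card B
  card-∪-∩ A B = begin
    card (A ∪ B) + card (A ∩ B)                   ≡⟨ sym (∑-distrib-+ (λ i → b2n ((A ∪ B) i)) (λ i → b2n ((A ∩ B) i))) ⟩
    ∑ (λ i → b2n (A i ∨ B i) + b2n (A i ∧ B i))   ≡⟨ ∑-cong (λ i → b2n-∨-∧ (A i) (B i)) ⟩
    ∑ (λ i → b2n (A i) + b2n (B i))               ≡⟨ ∑-distrib-+ (λ i → b2n (A i)) (λ i → b2n (B i)) ⟩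
    card A + card B                               ∎
    where open ≡-Reasoning

  card-insert : ∀ x {A : VSet n} → A x ≡ false → card (insert x A) ≡ suc (card A)
  card-insert x {A} Ax = begin
    card (insert x A)              ≡⟨ ∑-cong (λ i → b2n-∨-disjoint _ (A i) (insert-disjoint x Ax i)) ⟩
    ∑ (λ i → δ x i + b2n (A i))    ≡⟨ ∑-distrib-+ (δ x) (λ i → b2n (A i)) ⟩
    ∑ (δ x) + card A               ≡⟨ cong (_+ card A) (∑-δ≡1 x) ⟩
    suc (card A)                   ∎
    where open ≡-Reasoning

module _ (G : Graph) where

  private
    V = Fin (n G)

  ordAdj : V → V → Bool
  ordAdj i j = (toℕ i <ᵇ toℕ j) ∧ adj G i j

  edgeIn : VSet (n G) → V → V → ℕ
  edgeIn A i j = b2n (ordAdj i j ∧ (A i ∧ A j))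

  degreeIn : VSet (n G) → V → ℕ
  degreeIn A x = ∑ (λ j → b2n (adj G x j ∧ A j))

  edgesIn-∑ : ∀ A → edgesIn G A ≡ ∑ (λ i → ∑ (edgeIn A i))
  edgesIn-∑ A = ∑-cong (λ i → ∑-cong (λ j → cong b2n (∧-edge-term (toℕ i <ᵇ toℕ j) (A i) (A j) (adj G i j))))

  edgesIn-supermodular : ∀ A B → edgesIn G A + edgesIn G B ≤ edgesIn G (A ∪ B) + edgesIn G (A ∩ B)
  edgesIn-supermodular A B = begin
    edgesIn G A + edgesIn G B
      ≡⟨ cong₂ _+_ (edgesIn-∑ A) (edgesIn-∑ B) ⟩
    ∑ (λ i → ∑ (edgeIn A i)) + ∑ (λ i → ∑ (edgeIn B i))
      ≤⟨ ∑-+-mono-≤ (λ i → ∑-+-mono-≤ (λ j → pair-supermodular (ordAdj i j) (A i) (B i) (A j) (B j))) ⟩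
    ∑ (λ i → ∑ (edgeIn (A ∪ B) i)) + ∑ (λ i → ∑ (edgeIn (A ∩ B) i))
      ≡⟨ sym (cong₂ _+_ (edgesIn-∑ (A ∪ B)) (edgesIn-∑ (A ∩ B))) ⟩
    edgesIn G (A ∪ B) + edgesIn G (A ∩ B) ∎
    where open ≤-Reasoning

  degreeIn≤ordAdj : ∀ A x → degreeIn A x ≤ ∑ (λ j → b2n (ordAdj x j ∧ A j)) + ∑ (λ i → b2n (ordAdj i x ∧ A i))
  degreeIn≤ordAdj A x =
    ≤-trans (∑-mono-≤ both-orders) (≤-reflexive (∑-distrib-+ (λ j → b2n (ordAdj x j ∧ A j)) (λ j → b2n (ordAdj j x ∧ A j))))
    where
    both-orders : ∀ j → b2n (adj G x j ∧ A j) ≤ b2n (ordAdj x j ∧ A j) + b2n (ordAdj j x ∧ A j)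
    both-orders j with x ≟ᶠ j
    ... | yes refl rewrite irrefl G x = z≤n
    ... | no x≢j rewrite adj-sym G j x =
      either-order (toℕ x <ᵇ toℕ j) (toℕ j <ᵇ toℕ x) (adj G x j) (A j) (<ᵇ-connex x≢j)

  edgesIn-insert : ∀ {T x} → T x ≡ false → edgesIn G T + degreeIn T x ≤ edgesIn G (insert x T)
  edgesIn-insert {T} {x} Tx = begin
    edgesIn G T + degreeIn T x
      ≤⟨ +-monoʳ-≤ (edgesIn G T) (degreeIn≤ordAdj T x) ⟩
    edgesIn G T + (∑ (row x) + ∑ (λ i → col i x))
      ≡⟨ cong₂ _+_ (edgesIn-∑ T) (cong₂ _+_ (sym (∑∑-δ-row row x)) (sym (∑∑-δ-column col x))) ⟩
    ∑ (λ i → ∑ (edgeIn T i)) + (∑ (λ i → ∑ (λ j → row i j * δ x i)) + ∑ (λ i → ∑ (λ j → col i j * δ x j)))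
      ≡⟨ ∑-distrib-+₃ (λ i → ∑ (edgeIn T i)) (λ i → ∑ (λ j → row i j * δ x i)) (λ i → ∑ (λ j → col i j * δ x j)) ⟩
    ∑ (λ i → ∑ (edgeIn T i) + (∑ (λ j → row i j * δ x i) + ∑ (λ j → col i j * δ x j)))
      ≡⟨ ∑-cong (λ i → ∑-distrib-+₃ (edgeIn T i) (λ j → row i j * δ x i) (λ j → col i j * δ x j)) ⟩
    ∑ (λ i → ∑ (λ j → edgeIn T i j + (row i j * δ x i + col i j * δ x j)))
      ≤⟨ ∑-mono-≤ (λ i → ∑-mono-≤ (λ j →
           pair-insert (ordAdj i j) _ _ (T i) (T j) (insert-disjoint x Tx i) (insert-disjoint x Tx j))) ⟩
    ∑ (λ i → ∑ (edgeIn (insert x T) i))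
      ≡⟨ sym (edgesIn-∑ (insert x T)) ⟩
    edgesIn G (insert x T) ∎
    where
    open ≤-Reasoning
    row col : V → V → ℕ
    row i j = b2n (ordAdj i j ∧ T j)
    col i j = b2n (ordAdj i j ∧ T i)

  neighbour⇒1≤degreeIn : ∀ {A x y} → adj G x y ≡ true → A y ≡ true → 1 ≤ degreeIn A x
  neighbour⇒1≤degreeIn {A} {x} {y} xy Ay =
    ≤-trans (≤-reflexive (sym counted)) (term≤∑ (λ j → b2n (adj G x j ∧ A j)) y)
    where
    counted : b2n (adj G x y ∧ A y) ≡ 1
    counted rewrite xy | Ay = refl

  neighbours⇒2≤degreeIn : ∀ {A x y z} → adj G x y ≡ true → A y ≡ true → adj G x z ≡ true → A z ≡ true →
                          y ≢ z → 2 ≤ degreeIn A x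
  neighbours⇒2≤degreeIn {A} {x} {y} {z} xy Ay xz Az y≢z =
    ≤-trans (≤-reflexive (sym counted)) (pair≤∑ (λ j → b2n (adj G x j ∧ A j)) y≢z)
    where
    counted : b2n (adj G x y ∧ A y) + b2n (adj G x z ∧ A z) ≡ 2
    counted rewrite xy | Ay | xz | Az = refl

cancel-7 : ∀ {a b s} → a + 7 ≤ b + (s + 9) → a ≤ b + (s + 2)
cancel-7 {a} {b} {s} h = +-cancelʳ-≤ 7 a (b + (s + 2)) (≤-trans h (≤-reflexive (shape b s)))
  where
  shape : ∀ b s → b + (s + 9) ≡ b + (s + 2) + 7
  shape = solve-∀

module _ (G : Graph) where

  private
    V = Fin (n G)

  -- 9 * card A ≤ 7 * edgesIn G A + s says ρ_G(A) ≤ s without leaving ℕ.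
  ρ-insert : ∀ {T x} d s → T x ≡ false → d ≤ degreeIn G T x → 9 * card T ≤ 7 * edgesIn G T + s →
             9 * card (insert x T) + 7 * d ≤ 7 * edgesIn G (insert x T) + (s + 9)
  ρ-insert {T} {x} d s Tx d≤deg ρT≤s = begin
    9 * card (insert x T) + 7 * d                  ≡⟨ cong (λ c → 9 * c + 7 * d) (card-insert x Tx) ⟩
    9 * suc (card T) + 7 * d                       ≡⟨ card-shape (card T) d ⟩
    9 * card T + (7 * d + 9)                       ≤⟨ +-monoˡ-≤ (7 * d + 9) ρT≤s ⟩
    7 * edgesIn G T + s + (7 * d + 9)              ≤⟨ +-monoʳ-≤ (7 * edgesIn G T + s) (+-monoˡ-≤ 9 (*-monoʳ-≤ 7 d≤deg)) ⟩
    7 * edgesIn G T + s + (7 * degreeIn G T x + 9) ≡⟨ edge-shape (edgesIn G T) s (degreeIn G T x) ⟩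
    7 * (edgesIn G T + degreeIn G T x) + (s + 9)   ≤⟨ +-monoˡ-≤ (s + 9) (*-monoʳ-≤ 7 (edgesIn-insert G Tx)) ⟩
    7 * edgesIn G (insert x T) + (s + 9)           ∎
    where
    open ≤-Reasoning
    card-shape : ∀ c d → 9 * suc c + 7 * d ≡ 9 * c + (7 * d + 9)
    card-shape = solve-∀
    edge-shape : ∀ e s g → 7 * e + s + (7 * g + 9) ≡ 7 * (e + g) + (s + 9)
    edge-shape = solve-∀

  ρ-insert-neighbour : ∀ {T x y} s → T x ≡ false → adj G x y ≡ true → T y ≡ true →
                       9 * card T ≤ 7 * edgesIn G T + s →
                       9 * card (insert x T) ≤ 7 * edgesIn G (insert x T) + (s + 2)
  ρ-insert-neighbour {T} {x} s Tx xy Ty ρT≤s =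
    cancel-7 {b = 7 * edgesIn G (insert x T)} (ρ-insert 1 s Tx (neighbour⇒1≤degreeIn G xy Ty) ρT≤s)

  ρ-insert-neighbours : ∀ {T x y z} s → T x ≡ false → adj G x y ≡ true → T y ≡ true →
                        adj G x z ≡ true → T z ≡ true → y ≢ z → 9 * card T ≤ 7 * edgesIn G T + s →
                        9 * card (insert x T) + 7 ≤ 7 * edgesIn G (insert x T) + (s + 2)
  ρ-insert-neighbours {T} {x} s Tx xy Ty xz Tz y≢z ρT≤s =
    cancel-7 {b = 7 * edgesIn G (insert x T)}
      (≤-trans (≤-reflexive (+-assoc (9 * card (insert x T)) 7 7))
               (ρ-insert 2 s Tx (neighbours⇒2≤degreeIn G xy Ty xz Tz y≢z) ρT≤s))

  -- Each internal vertex but the last brings one new edge, the last one two.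
  ρ-along-path : ∀ k (T : VSet (n G)) (w : Fin (3 + k) → V) → Injective _≡_ _≡_ w →
                 (∀ i → adj G (w (inject₁ i)) (w (suc i)) ≡ true) →
                 T (w zero) ≡ true → T (w (fromℕ (2 + k))) ≡ true → (∀ i → T (w (suc (inject₁ i))) ≡ false) →
                 ∀ s → 9 * card T ≤ 7 * edgesIn G T + s →
                 ∃[ T′ ] 9 * card T′ + 7 ≤ 7 * edgesIn G T′ + (s + 2 * suc k)
  ρ-along-path zero T w inj adjacent Tu Tv interior s ρT≤s =
    insert p₁ T ,
    ρ-insert-neighbours {T} {p₁} {w zero} {w (suc (suc zero))} s (interior zero)
      (trans (adj-sym G p₁ (w zero)) (adjacent zero)) Tu (adjacent (suc zero)) Tv ((λ ()) ∘ inj) ρT≤s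
    where
    p₁ = w (suc zero)
  ρ-along-path (suc k) T w inj adjacent Tu Tv interior s ρT≤s =
    let T′ , ρT′ = ρ-along-path k (insert p₁ T) (w ∘ suc) (suc-injective ∘ inj) (adjacent ∘ suc)
                     (insert-∋ p₁ T) (insert-⊇ p₁ T Tv) interior₁ (s + 2) ρT₁
    in T′ , ≤-trans ρT′ (≤-reflexive (cong (_+_ (7 * edgesIn G T′)) (shape s k)))
    where
    p₁ = w (suc zero)
    interior₁ : ∀ i → insert p₁ T (w (suc (suc (inject₁ i)))) ≡ false
    interior₁ i = trans (insert-∌ p₁ T ((λ ()) ∘ suc-injective ∘ inj)) (interior (suc i))
    ρT₁ : 9 * card (insert p₁ T) ≤ 7 * edgesIn G (insert p₁ T) + (s + 2)
    ρT₁ = ρ-insert-neighbour {T} {p₁} {w zero} s (interior zero) (trans (adj-sym G p₁ (w zero)) (adjacent zero)) Tu ρT≤s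
    shape : ∀ s k → s + 2 + 2 * suc k ≡ s + 2 * suc (suc k)
    shape = solve-∀

  madOK⇒7e≤9c : MadOK G → ∀ A → 7 * edgesIn G A ≤ 9 * card A
  madOK⇒7e≤9c mad A = ℤ.drop‿+≤+ (ℤ.0≤i-j⇒j≤i (mad A))

  ρ≤0⇒9c≤7e : ∀ {A} → ρ G A ≤ℤ + 0 → 9 * card A ≤ 7 * edgesIn G A
  ρ≤0⇒9c≤7e ρA≤0 = ℤ.drop‿+≤+ (ℤ.i-j≤0⇒i≤j ρA≤0)

  -- ρ(A ∪ B) ≤ ρ(A) + ρ(B) - ρ(A ∩ B) and ρ(A ∩ B) ≥ 0.
  ρ≤0-∪ : MadOK G → ∀ {A B} → 9 * card A ≤ 7 * edgesIn G A → 9 * card B ≤ 7 * edgesIn G B →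
          9 * card (A ∪ B) ≤ 7 * edgesIn G (A ∪ B)
  ρ≤0-∪ mad {A} {B} ρA≤0 ρB≤0 = +-cancelʳ-≤ (9 * card (A ∩ B)) _ _ (begin
    9 * card (A ∪ B) + 9 * card (A ∩ B)            ≡⟨ sym (*-distribˡ-+ 9 (card (A ∪ B)) (card (A ∩ B))) ⟩
    9 * (card (A ∪ B) + card (A ∩ B))              ≡⟨ cong (9 *_) (card-∪-∩ A B) ⟩
    9 * (card A + card B)                          ≡⟨ *-distribˡ-+ 9 (card A) (card B) ⟩
    9 * card A + 9 * card B                        ≤⟨ +-mono-≤ ρA≤0 ρB≤0 ⟩
    7 * edgesIn G A + 7 * edgesIn G B              ≡⟨ sym (*-distribˡ-+ 7 (edgesIn G A) (edgesIn G B)) ⟩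
    7 * (edgesIn G A + edgesIn G B)                ≤⟨ *-monoʳ-≤ 7 (edgesIn-supermodular G A B) ⟩
    7 * (edgesIn G (A ∪ B) + edgesIn G (A ∩ B))    ≡⟨ *-distribˡ-+ 7 (edgesIn G (A ∪ B)) (edgesIn G (A ∩ B)) ⟩
    7 * edgesIn G (A ∪ B) + 7 * edgesIn G (A ∩ B)  ≤⟨ +-monoʳ-≤ (7 * edgesIn G (A ∪ B)) (madOK⇒7e≤9c mad (A ∩ B)) ⟩
    7 * edgesIn G (A ∪ B) + 9 * card (A ∩ B)       ∎)
    where open ≤-Reasoning

  private
    admissible? : (X : VSet (n G)) (a : V) (S : VSet (n G)) → Dec ((singleton a ⊆ᵇ S) ∧ (S ⊆ᵇ X) ≡ true)
    admissible? X a S = (singleton a ⊆ᵇ S) ∧ (S ⊆ᵇ X) ≟ᵇ true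

  ρ*In-attained : ∀ {X a} → X a ≡ true → ∃[ S ] S ⊆ X × S a ≡ true × ρ G S ≡ ρ*In G X (singleton a)
  ρ*In-attained {X} {a} Xa with foldr-selective ℤ.⊓-sel (ρ G X) (map (ρ G) (filter (admissible? X a) (allSubsets (n G))))
  ... | inj₁ ρ*≡ρX = X , (λ _ Xi → Xi) , Xa , sym ρ*≡ρX
  ... | inj₂ ρ*∈ with ∈-map⁻ (ρ G) ρ*∈
  ...   | S , S∈ , ρ*≡ρS with ∈-filter⁻ (admissible? X a) {xs = allSubsets (n G)} S∈
  ...     | _ , admissible =
    S , ⊆ᵇ⇒⊆ {A = S} {B = X} (∧-conicalʳ _ _ admissible) ,
    ⊆ᵇ⇒⊆ {A = singleton a} {B = S} (∧-conicalˡ _ _ admissible) a (dec-true (a ≟ᶠ a) refl) , sym ρ*≡ρS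

  nonpositive-pair : MadOK G → ∀ {X u v} → X u ≡ true → X v ≡ true →
                     ρ*In G X (singleton u) ≤ℤ + 0 → ρ*In G X (singleton v) ≤ℤ + 0 →
                     ∃[ T ] T ⊆ X × T u ≡ true × T v ≡ true × 9 * card T ≤ 7 * edgesIn G T
  nonpositive-pair mad Xu Xv ρ*u≤0 ρ*v≤0 with ρ*In-attained Xu | ρ*In-attained Xv
  ... | Su , Su⊆X , Su∋u , ρSu≡ρ*u | Sv , Sv⊆X , Sv∋v , ρSv≡ρ*v =
    Su ∪ Sv , ∪-⊆ Su⊆X Sv⊆X , cong (_∨ Sv _) Su∋u , trans (cong (Su _ ∨_) Sv∋v) (∨-zeroʳ _) ,
    ρ≤0-∪ mad (ρ≤0⇒9c≤7e (subst (_≤ℤ + 0) (sym ρSu≡ρ*u) ρ*u≤0)) (ρ≤0⇒9c≤7e (subst (_≤ℤ + 0) (sym ρSv≡ρ*v) ρ*v≤0))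

module _ {G : Graph} {k : ℕ} (path : KPath G k) where
  open KPath path

  outsideP-interior : ∀ i → outsideP (w (suc (inject₁ i))) ≡ false
  outsideP-interior i = cong not (to T-≡ (any⁺ _ (Any.map
    (λ { refl → from T-≡ (dec-true (w (suc (inject₁ i)) ≟ᶠ w (suc (inject₁ i))) refl) }) (∈-allFin i))))

  outsideP-∋ : ∀ {x} → (∀ i → w (suc (inject₁ i)) ≢ x) → outsideP x ≡ true
  outsideP-∋ {x} avoids = cong not (¬-not λ inP≡true →
    let i , hit = Any.satisfied (any⁻ _ (allFin k) (from T-≡ inP≡true))
    in subst T (dec-false (_ ≟ᶠ x) (avoids i)) hit)

  outsideP-start : outsideP start ≡ true
  outsideP-start = outsideP-∋ (λ i → (λ ()) ∘ injective)

  outsideP-end : outsideP end ≡ true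
  outsideP-end = outsideP-∋ (λ i → fromℕ≢inject₁ ∘ sym ∘ suc-injective ∘ injective)

module _ {G : Graph} (mad : MadOK G) {k : ℕ} (path : KPath G (suc k)) where
  open KPath path

  short-path-ends-not-both-nonpositive :
    k ≤ 2 → ρ*In G outsideP (singleton start) ≤ℤ + 0 → ρ*In G outsideP (singleton end) ≤ℤ + 0 → ⊥
  short-path-ends-not-both-nonpositive k≤2 ρ*u≤0 ρ*v≤0 =
    let T , T⊆X , Tu , Tv , ρT≤0 = nonpositive-pair G mad (outsideP-start path) (outsideP-end path) ρ*u≤0 ρ*v≤0
        T′ , ρT′≤2k-7 = ρ-along-path G k T w injective adjacent Tu Tv (λ i → ⊆-∉ T⊆X (outsideP-interior path i))
                                     0 (≤-trans ρT≤0 (≤-reflexive (sym (+-identityʳ _))))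
    in <⇒≱ (negative (*-monoʳ-≤ 2 (s≤s k≤2)) ρT′≤2k-7) (madOK⇒7e≤9c G mad T′)
    where
    negative : ∀ {a b t} → t ≤ 6 → a + 7 ≤ b + (0 + t) → a < b
    negative {a} {b} {t} t≤6 h = +-cancelʳ-≤ 6 (suc a) b (begin
      suc a + 6   ≡⟨ +-comm (suc a) 6 ⟩
      7 + a       ≡⟨ +-comm 7 a ⟩
      a + 7       ≤⟨ h ⟩
      b + t       ≤⟨ +-monoʳ-≤ b t≤6 ⟩
      b + 6       ∎)
      where open ≤-Reasoning

lemma14 : (G : Graph) → MinimalCounterexample G →
    (k : ℕ) → 1 ≤ k → k ≤ 3 → (path : KPath G k) →
    ρ*In G (KPath.outsideP path) (singleton (KPath.start path))
      ≤ℤ ρ*In G (KPath.outsideP path) (singleton (KPath.end path)) →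
    + 1 ≤ℤ ρ*In G (KPath.outsideP path) (singleton (KPath.end path))
lemma14 G mc zero () _ _ _
lemma14 G mc (suc k) _ (s≤s k≤2) path ρ*u≤ρ*v = ℤ.≮⇒≥ λ ρ*v<1 →
  let ρ*v≤0 = ℤ.i<j⇒i≤pred[j] ρ*v<1
  in short-path-ends-not-both-nonpositive (MinimalCounterexample.madOK mc) path k≤2 (ℤ.≤-trans ρ*u≤ρ*v ρ*v≤0) ρ*v≤0
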